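{- Let $q,n,\ell$ be integers with $q\ge 2$, $n\ge 2$, $\ell\ge 1$, and suppose $(q,n,\ell)$ is not admissible, i.e., it is not the case that $(q,n)=(2,2)$, nor that $(n,\ell)=(2,1)$, nor that $(q,n,\ell)\in\{(2,3,1),(2,3,2),(3,2,2),(3,2,3),(3,3,1),(2,4,1),(4,2,2)\}$. Define $$F(q,n,\ell)=\frac{24}{25}n\ell-1-\frac{n\ell}{q}-\ell.$$ Then $F(q,n,\ell)>0$. -}

module Defs where

open import Data.Nat as ℕ using (ℕ)
open import Data.Product using (_×_)
open import Data.Sum using (_⊎_)
open import Relation.Binary.PropositionalEquality using (_≡_)
open import Data.Rational as ℚ using (ℚ; _+_; _-_; _*_; _÷_; 1ℚ)
open import Data.Integer using (+_)

Admissible : ℕ → ℕ → ℕ → Set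
Admissible q n ℓ =
    (q ≡ 2 × n ≡ 2)
  ⊎ (n ≡ 2 × ℓ ≡ 1)
  ⊎ (q ≡ 2 × n ≡ 3 × ℓ ≡ 1)
  ⊎ (q ≡ 2 × n ≡ 3 × ℓ ≡ 2)
  ⊎ (q ≡ 3 × n ≡ 2 × ℓ ≡ 2)
  ⊎ (q ≡ 3 × n ≡ 2 × ℓ ≡ 3)
  ⊎ (q ≡ 3 × n ≡ 3 × ℓ ≡ 1)
  ⊎ (q ≡ 2 × n ≡ 4 × ℓ ≡ 1)
  ⊎ (q ≡ 4 × n ≡ 2 × ℓ ≡ 2)

⟦_⟧ : ℕ → ℚ
⟦ k ⟧ = + k ℚ./ 1

F : (q n ℓ : ℕ) → .{{ℕ.NonZero q}} → ℚ
F q n ℓ = ((+ 24 ℚ./ 25) * ⟦ n ⟧ * ⟦ ℓ ⟧) - 1ℚ - (⟦ n ⟧ * ⟦ ℓ ⟧ * (+ 1 ℚ./ q)) - ⟦ ℓ ⟧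

{-# OPTIONS --safe #-}
module Submission where

-- Since 25q > 0, F(q,n,ℓ) > 0 amounts to the natural-number inequality
-- 24qnℓ > 25(q + nℓ + qℓ). Outside the admissible triples, (q,n,ℓ) lies in one
-- of nine regimes (n = 2, 3, 4 or n ≥ 5, with q and ℓ bounded below in each);
-- writing each variable as its least value in the regime plus an excess, the
-- difference of the two sides becomes a polynomial in the excesses with
-- nonnegative coefficients and positive constant term.

open import Defs
open import Data.Nat as ℕ using (ℕ; suc; _≥_; NonZero; s≤s)
open import Data.Nat.Tactic.RingSolver using (solve)
import Data.Nat.Coprimality as Coprimality
open import Data.Integer as ℤ using (+_)
import Data.Integer.Properties as ℤ
open import Data.Rational using (ℚ; mkℚ; _+_; _-_; _*_; _/_; 1ℚ; 0ℚ; _<_)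
import Data.Rational.Properties as ℚ
open import Data.Rational.Solver using (module +-*-Solver)
open import Algebra.Properties.AbelianGroup ℚ.+-0-abelianGroup using (xyx⁻¹≈y)
open import Data.List using (_∷_; [])
open import Data.Product using (∃-syntax; _,_)
open import Data.Sum using (inj₁; inj₂)
open import Relation.Nullary using (¬_; contradiction)
open import Relation.Binary.PropositionalEquality

⟦⟧≡mkℚ : ∀ k → ⟦ k ⟧ ≡ mkℚ (+ k) 0 (Coprimality.sym (Coprimality.1-coprimeTo k))
⟦⟧≡mkℚ k = ℚ.↥p/↧p≡p _

⟦⟧-homo-+ : ∀ a b → ⟦ a ℕ.+ b ⟧ ≡ ⟦ a ⟧ + ⟦ b ⟧
⟦⟧-homo-+ a b = begin
  + (a ℕ.+ b) / 1                     ≡⟨ cong (_/ 1) (ℤ.pos-+ a b) ⟩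
  (+ a ℤ.+ + b) / 1                   ≡⟨ cong₂ (λ x y → (x ℤ.+ y) / 1) (ℤ.*-identityʳ (+ a)) (ℤ.*-identityʳ (+ b)) ⟨
  (+ a ℤ.* + 1 ℤ.+ + b ℤ.* + 1) / 1   ≡⟨ cong₂ _+_ (⟦⟧≡mkℚ a) (⟦⟧≡mkℚ b) ⟨
  ⟦ a ⟧ + ⟦ b ⟧                       ∎
  where open ≡-Reasoning

⟦⟧-homo-* : ∀ a b → ⟦ a ℕ.* b ⟧ ≡ ⟦ a ⟧ * ⟦ b ⟧
⟦⟧-homo-* a b = trans (cong (_/ 1) (ℤ.pos-* a b)) (sym (cong₂ _*_ (⟦⟧≡mkℚ a) (⟦⟧≡mkℚ b)))

⟦1+m⟧*[1/1+m]≡1 : ∀ m → ⟦ suc m ⟧ * (+ 1 / suc m) ≡ 1ℚ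
⟦1+m⟧*[1/1+m]≡1 m = trans (cong₂ _*_ (⟦⟧≡mkℚ (suc m)) (ℚ.↥p/↧p≡p inverse))
                         (ℚ.*-inverseʳ (mkℚ (+ suc m) 0 (Coprimality.sym (Coprimality.1-coprimeTo (suc m)))))
  where
  inverse : ℚ
  inverse = mkℚ (+ 1) m (Coprimality.1-coprimeTo (suc m))

⟦m⟧*p≡⟦1+k⟧⇒0<p : ∀ m k p → ⟦ m ⟧ * p ≡ ⟦ suc k ⟧ → 0ℚ < p
⟦m⟧*p≡⟦1+k⟧⇒0<p m k p eq = ℚ.*-cancelˡ-<-nonNeg ⟦ m ⟧ {{ℚ.normalize-nonNeg m 1}}
  (subst₂ _<_ (sym (ℚ.*-zeroʳ ⟦ m ⟧)) (sym eq) (ℚ.positive⁻¹ ⟦ suc k ⟧ {{ℚ.normalize-pos (suc k) 1}}))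

-- For q ≠ 0, the surplus k equals 25 q F(q,n,ℓ).
Surplus : ℕ → ℕ → ℕ → ℕ → Set
Surplus q n ℓ k = q ℕ.* n ℕ.* ℓ ℕ.* 24 ≡ 25 ℕ.* (q ℕ.+ n ℕ.* ℓ ℕ.+ q ℕ.* ℓ) ℕ.+ k

Surplus⇒ℚ : ∀ q n ℓ k → Surplus q n ℓ k →
            ⟦ q ⟧ * ⟦ n ⟧ * ⟦ ℓ ⟧ * ⟦ 24 ⟧ ≡ ⟦ 25 ⟧ * (⟦ q ⟧ + ⟦ n ⟧ * ⟦ ℓ ⟧ + ⟦ q ⟧ * ⟦ ℓ ⟧) + ⟦ k ⟧
Surplus⇒ℚ q n ℓ k eq = begin
  ⟦ q ⟧ * ⟦ n ⟧ * ⟦ ℓ ⟧ * ⟦ 24 ⟧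
    ≡⟨ cong (λ x → x * ⟦ ℓ ⟧ * ⟦ 24 ⟧) (⟦⟧-homo-* q n) ⟨
  ⟦ q ℕ.* n ⟧ * ⟦ ℓ ⟧ * ⟦ 24 ⟧
    ≡⟨ cong (_* ⟦ 24 ⟧) (⟦⟧-homo-* (q ℕ.* n) ℓ) ⟨
  ⟦ q ℕ.* n ℕ.* ℓ ⟧ * ⟦ 24 ⟧
    ≡⟨ ⟦⟧-homo-* (q ℕ.* n ℕ.* ℓ) 24 ⟨
  ⟦ q ℕ.* n ℕ.* ℓ ℕ.* 24 ⟧
    ≡⟨ cong ⟦_⟧ eq ⟩
  ⟦ 25 ℕ.* (q ℕ.+ n ℕ.* ℓ ℕ.+ q ℕ.* ℓ) ℕ.+ k ⟧
    ≡⟨ trans (⟦⟧-homo-+ (25 ℕ.* (q ℕ.+ n ℕ.* ℓ ℕ.+ q ℕ.* ℓ)) k)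
             (cong (_+ ⟦ k ⟧) (⟦⟧-homo-* 25 (q ℕ.+ n ℕ.* ℓ ℕ.+ q ℕ.* ℓ))) ⟩
  ⟦ 25 ⟧ * ⟦ q ℕ.+ n ℕ.* ℓ ℕ.+ q ℕ.* ℓ ⟧ + ⟦ k ⟧
    ≡⟨ cong (λ x → ⟦ 25 ⟧ * x + ⟦ k ⟧)
            (trans (⟦⟧-homo-+ (q ℕ.+ n ℕ.* ℓ) (q ℕ.* ℓ)) (cong (_+ ⟦ q ℕ.* ℓ ⟧) (⟦⟧-homo-+ q (n ℕ.* ℓ)))) ⟩
  ⟦ 25 ⟧ * (⟦ q ⟧ + ⟦ n ℕ.* ℓ ⟧ + ⟦ q ℕ.* ℓ ⟧) + ⟦ k ⟧
    ≡⟨ cong₂ (λ x y → ⟦ 25 ⟧ * (⟦ q ⟧ + x + y) + ⟦ k ⟧) (⟦⟧-homo-* n ℓ) (⟦⟧-homo-* q ℓ) ⟩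
  ⟦ 25 ⟧ * (⟦ q ⟧ + ⟦ n ⟧ * ⟦ ℓ ⟧ + ⟦ q ⟧ * ⟦ ℓ ⟧) + ⟦ k ⟧
    ∎
  where open ≡-Reasoning

clear-denominators : ∀ d c A N L r →
  d * A * (c * N * L - 1ℚ - N * L * r - L) ≡ A * N * L * (d * c) - d * (A + N * L * (A * r) + A * L)
clear-denominators = +-*-Solver.solve 6 (λ d c A N L r →
  d :* A :* (c :* N :* L :- con 1ℚ :- N :* L :* r :- L)
    := A :* N :* L :* (d :* c) :- d :* (A :+ N :* L :* (A :* r) :+ A :* L)) refl
  where open +-*-Solver using (_:+_; _:*_; _:-_; con; _:=_)

Surplus⇒25qF≡ : ∀ m n ℓ k → Surplus (suc m) n ℓ k → ⟦ 25 ℕ.* suc m ⟧ * F (suc m) n ℓ ≡ ⟦ k ⟧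
Surplus⇒25qF≡ m n ℓ k eq = begin
  ⟦ 25 ℕ.* q ⟧ * F q n ℓ
    ≡⟨ cong (_* F q n ℓ) (⟦⟧-homo-* 25 q) ⟩
  ⟦ 25 ⟧ * Q * F q n ℓ
    -- ⟦ 25 ⟧ * (+ 24 / 25) computes to ⟦ 24 ⟧
    ≡⟨ clear-denominators ⟦ 25 ⟧ (+ 24 / 25) Q N L (+ 1 / q) ⟩
  Q * N * L * ⟦ 24 ⟧ - ⟦ 25 ⟧ * (Q + N * L * (Q * (+ 1 / q)) + Q * L)
    ≡⟨ cong (λ x → Q * N * L * ⟦ 24 ⟧ - ⟦ 25 ⟧ * (Q + x + Q * L))
            (trans (cong (N * L *_) (⟦1+m⟧*[1/1+m]≡1 m)) (ℚ.*-identityʳ (N * L))) ⟩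
  Q * N * L * ⟦ 24 ⟧ - ⟦ 25 ⟧ * (Q + N * L + Q * L)
    ≡⟨ cong (_- ⟦ 25 ⟧ * (Q + N * L + Q * L)) (Surplus⇒ℚ q n ℓ k eq) ⟩
  ⟦ 25 ⟧ * (Q + N * L + Q * L) + ⟦ k ⟧ - ⟦ 25 ⟧ * (Q + N * L + Q * L)
    ≡⟨ xyx⁻¹≈y (⟦ 25 ⟧ * (Q + N * L + Q * L)) ⟦ k ⟧ ⟩
  ⟦ k ⟧
    ∎
  where
  open ≡-Reasoning
  q = suc m
  Q = ⟦ q ⟧
  N = ⟦ n ⟧
  L = ⟦ ℓ ⟧

positive-surplus : ∀ q n ℓ → q ≥ 2 → n ≥ 2 → ℓ ≥ 1 → ¬ Admissible q n ℓ → ∃[ k ] Surplus q n ℓ (suc k)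
positive-surplus 3 2 2 _ _ _ ¬adm = contradiction (inj₂ (inj₂ (inj₂ (inj₂ (inj₁ (refl , refl , refl)))))) ¬adm
positive-surplus 3 2 3 _ _ _ ¬adm = contradiction (inj₂ (inj₂ (inj₂ (inj₂ (inj₂ (inj₁ (refl , refl , refl))))))) ¬adm
positive-surplus 4 2 2 _ _ _ ¬adm = contradiction (inj₂ (inj₂ (inj₂ (inj₂ (inj₂ (inj₂ (inj₂ (inj₂ (refl , refl , refl))))))))) ¬adm
positive-surplus 2 3 1 _ _ _ ¬adm = contradiction (inj₂ (inj₂ (inj₁ (refl , refl , refl)))) ¬adm
positive-surplus 2 3 2 _ _ _ ¬adm = contradiction (inj₂ (inj₂ (inj₂ (inj₁ (refl , refl , refl))))) ¬adm
positive-surplus 3 3 1 _ _ _ ¬adm = contradiction (inj₂ (inj₂ (inj₂ (inj₂ (inj₂ (inj₂ (inj₁ (refl , refl , refl)))))))) ¬adm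
positive-surplus 2 4 1 _ _ _ ¬adm = contradiction (inj₂ (inj₂ (inj₂ (inj₂ (inj₂ (inj₂ (inj₂ (inj₁ (refl , refl , refl))))))))) ¬adm
positive-surplus q 2 1 _ _ _ ¬adm = contradiction (inj₂ (inj₁ (refl , refl))) ¬adm
positive-surplus 2 2 ℓ _ _ _ ¬adm = contradiction (inj₁ (refl , refl)) ¬adm
positive-surplus 3 2 (suc (suc (suc (suc c)))) _ _ _ _ = 19 ℕ.* c , solve (c ∷ [])
positive-surplus 4 2 (suc (suc (suc c))) _ _ _ _ = 25 ℕ.+ 42 ℕ.* c , solve (c ∷ [])
positive-surplus (suc (suc (suc (suc (suc a))))) 2 (suc (suc c)) _ _ _ _ =
  4 ℕ.+ 65 ℕ.* c ℕ.+ 21 ℕ.* a ℕ.+ 23 ℕ.* a ℕ.* c , solve (a ∷ c ∷ [])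
positive-surplus 2 3 (suc (suc (suc c))) _ _ _ _ = 6 ℕ.+ 19 ℕ.* c , solve (c ∷ [])
positive-surplus 3 3 (suc (suc c)) _ _ _ _ = 56 ℕ.+ 66 ℕ.* c , solve (c ∷ [])
positive-surplus (suc (suc (suc (suc a)))) 3 (suc c) _ _ _ _ =
  12 ℕ.+ 113 ℕ.* c ℕ.+ 22 ℕ.* a ℕ.+ 47 ℕ.* a ℕ.* c , solve (a ∷ c ∷ [])
positive-surplus 2 4 (suc (suc c)) _ _ _ _ = 33 ℕ.+ 42 ℕ.* c , solve (c ∷ [])
positive-surplus (suc (suc (suc a))) 4 (suc c) _ _ _ _ =
  37 ℕ.+ 113 ℕ.* c ℕ.+ 46 ℕ.* a ℕ.+ 71 ℕ.* a ℕ.* c , solve (a ∷ c ∷ [])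
positive-surplus (suc (suc a)) (suc (suc (suc (suc (suc b))))) (suc c) _ _ _ _ =
  14 ℕ.+ 65 ℕ.* c ℕ.+ 23 ℕ.* b ℕ.+ 23 ℕ.* b ℕ.* c ℕ.+ 70 ℕ.* a ℕ.+ 95 ℕ.* a ℕ.* c
     ℕ.+ 24 ℕ.* a ℕ.* b ℕ.+ 24 ℕ.* a ℕ.* b ℕ.* c , solve (a ∷ b ∷ c ∷ [])
positive-surplus 0 _ _ () _ _ _
positive-surplus 1 _ _ (s≤s ()) _ _ _
positive-surplus _ 0 _ _ () _ _
positive-surplus _ 1 _ _ (s≤s ()) _ _
positive-surplus _ _ 0 _ _ () _

mainTheorem2 : (q n ℓ : ℕ) → .{{_ : NonZero q}} → q ≥ 2 → n ≥ 2 → ℓ ≥ 1 → ¬ Admissible q n ℓ → 0ℚ < F q n ℓ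
mainTheorem2 (suc m) n ℓ q≥2 n≥2 ℓ≥1 ¬adm with positive-surplus (suc m) n ℓ q≥2 n≥2 ℓ≥1 ¬adm
... | k , surplus = ⟦m⟧*p≡⟦1+k⟧⇒0<p (25 ℕ.* suc m) k (F (suc m) n ℓ) (Surplus⇒25qF≡ m n ℓ (suc k) surplus)
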